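{- There exist two trees $T_1$ and $T_2$ with the same number of vertices such that $D(T_1)<D(T_2)$ and $W_4(T_1)<W_4(T_2)$. In particular, $D(T_1)<D(T_2)$ does not in general imply $W_\ell(T_1)>W_\ell(T_2)$.
   Context: For a tree $T$, $D(T)=\sum_{\{x,y\}\subseteq V(T)} d(x,y)$ is the sum of distances between pairs of vertices, and $W_\ell(T)$ is the number of closed walks of length $\ell$ in $T$ (walks $v_0v_1\dots v_\ell$ with consecutive vertices adjacent and $v_0=v_\ell$). -}

module Defs where

open import Data.Nat using (ℕ; zero; suc; _+_; _*_; _<_; _<ᵇ_)
open import Data.Fin using (Fin; toℕ)
open import Data.Bool using (Bool; true; false; if_then_else_)
open import Data.Product using (Σ; _×_; ∃)
open import Relation.Binary.PropositionalEquality using (_≡_)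
open import Data.Fin using (_≟_)
open import Relation.Nullary using (does)

ΣFin : (n : ℕ) → (Fin n → ℕ) → ℕ
ΣFin zero    f = 0
ΣFin (suc n) f = f Data.Fin.zero + ΣFin n (λ i → f (Data.Fin.suc i))

record Graph (n : ℕ) : Set where
  field
    adj     : Fin n → Fin n → Bool
    sym     : ∀ x y → adj x y ≡ adj y x
    irrefl  : ∀ x → adj x x ≡ false
open Graph public

b2n : Bool → ℕ
b2n true  = 1
b2n false = 0

walks : ∀ {n} → Graph n → ℕ → Fin n → Fin n → ℕ
walks {n} G zero    x y = b2n (does (x ≟ y))
walks {n} G (suc k) x y = ΣFin n (λ z → b2n (adj G x z) * walks G k z y)

W : ∀ {n} → ℕ → Graph n → ℕ
W {n} ℓ G = ΣFin n (λ x → walks G ℓ x x)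

Connected : ∀ {n} → Graph n → Set
Connected G = ∀ x y → ∃ λ k → 0 < walks G k x y

edges : ∀ {n} → Graph n → ℕ
edges {n} G = ΣFin n (λ x → ΣFin n (λ y →
  if toℕ x <ᵇ toℕ y then b2n (adj G x y) else 0))

-- A tree: a connected graph on n vertices with n - 1 edges
-- (stated as edges + 1 ≡ n; this forces n ≥ 1).
IsTree : ∀ {n} → Graph n → Set
IsTree {n} G = Connected G × (edges G + 1 ≡ n)

-- Search k = 0,1,…,bound; in a connected
-- graph on n vertices the distance is < n, so bound n suffices.
private
  search : ∀ {n} → Graph n → Fin n → Fin n → ℕ → ℕ → ℕ
  search G x y k zero      = k
  search G x y k (suc fuel) =
    if 0 <ᵇ walks G k x y then k else search G x y (suc k) fuel

dist : ∀ {n} → Graph n → Fin n → Fin n → ℕ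
dist {n} G x y = search G x y 0 n

D : ∀ {n} → Graph n → ℕ
D {n} G = ΣFin n (λ x → ΣFin n (λ y →
  if toℕ x <ᵇ toℕ y then dist G x y else 0))

module Submission where

-- The theorem is witnessed by two explicit trees on eight vertices, both
-- consisting of a central path a – b – c with leaves attached:
--
--   T₁ : two leaves at a, one leaf at b, two leaves at c;
--   T₂ : three leaves at a, no leaf at b, two leaves at c.
--
-- Moving the leaf from the middle vertex b to the end vertex a lengthens
-- the tree, so D increases (D T₁ = 65 < 66 = D T₂); but in a tree
-- W₄ = 2 Σ deg(v)² − 2(n − 1), and the degrees (3,3,3) of a, b, c become
-- the more uneven (4,2,3), so W₄ increases as well (50 < 54).

open import Defs
open import Data.Nat using (ℕ; _<_; _<?_)
open import Data.Bool using (Bool; false; _∧_; _∨_)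
open import Data.Bool.Properties using (∨-comm) renaming (_≟_ to _≟ᵇ_)
open import Data.Fin using (Fin; _≟_; #_)
open import Data.Fin.Properties using (all?)
open import Data.List using (List; []; _∷_)
open import Data.Bool.ListAction using (any)
open import Data.Product using (Σ; _×_; _,_)
open import Relation.Binary.PropositionalEquality using (_≡_; refl; cong)
open import Relation.Nullary using (Dec; does)
open import Relation.Nullary.Decidable using (from-yes)

listed : ∀ {n} → List (Fin n × Fin n) → Fin n → Fin n → Bool
listed es x y = any (λ { (u , v) → does (u ≟ x) ∧ does (v ≟ y) }) es

Loopless : ∀ {n} → List (Fin n × Fin n) → Set
Loopless {n} es = ∀ (x : Fin n) → listed es x x ≡ false

loopless? : ∀ {n} (es : List (Fin n × Fin n)) → Dec (Loopless es)
loopless? es = all? λ x → listed es x x ≟ᵇ false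

graphOf : ∀ {n} (es : List (Fin n × Fin n)) → Loopless es → Graph n
graphOf es loopless = record
  { adj    = λ x y → listed es x y ∨ listed es y x
  ; sym    = λ x y → ∨-comm (listed es x y) (listed es y x)
  ; irrefl = λ x → cong (λ b → b ∨ b) (loopless x)
  }

connected-by-dist : ∀ {n} (G : Graph n) →
  (∀ x y → 0 < walks G (dist G x y) x y) → Connected G
connected-by-dist G joined x y = dist G x y , joined x y

connected? : ∀ {n} (G : Graph n) → Dec (∀ x y → 0 < walks G (dist G x y) x y)
connected? G = all? λ x → all? λ y → 0 <? walks G (dist G x y) x y

-- Vertices are numbered so that a = 7, b = 5, c = 6.
T₁-edges T₂-edges : List (Fin 8 × Fin 8)
T₁-edges = (# 0 , # 7) ∷ (# 1 , # 7) ∷ (# 4 , # 5) ∷ (# 2 , # 6) ∷ (# 3 , # 6) ∷ (# 7 , # 5) ∷ (# 5 , # 6) ∷ []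
T₂-edges = (# 0 , # 7) ∷ (# 1 , # 7) ∷ (# 2 , # 7) ∷ (# 3 , # 6) ∷ (# 4 , # 6) ∷ (# 7 , # 5) ∷ (# 5 , # 6) ∷ []

T₁ T₂ : Graph 8
T₁ = graphOf T₁-edges (from-yes (loopless? T₁-edges))
T₂ = graphOf T₂-edges (from-yes (loopless? T₂-edges))

T₁-tree : IsTree T₁
T₁-tree = connected-by-dist T₁ (from-yes (connected? T₁)) , refl

T₂-tree : IsTree T₂
T₂-tree = connected-by-dist T₂ (from-yes (connected? T₂)) , refl

mainTheorem8 : Σ ℕ λ n → Σ (Graph n) λ T₁ → Σ (Graph n) λ T₂ →
    IsTree T₁ × IsTree T₂ × D T₁ < D T₂ × W 4 T₁ < W 4 T₂
mainTheorem8 =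
  8 , T₁ , T₂ , T₁-tree , T₂-tree
    , from-yes (D T₁ <? D T₂)
    , from-yes (W 4 T₁ <? W 4 T₂)
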